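{- For every integer $d\ge2$, the map $n\mapsto S_d(n)$ from $\mathbb N=\{0,1,2,\dots\}$ to $\mathcal S_d$ is surjective.
   Context: The Stern sequence $(s(n))_{n\ge0}$ is defined by $s(0)=0$, $s(1)=1$, $s(2n)=s(n)$, $s(2n+1)=s(n)+s(n+1)$. For an integer $d\ge2$, let $S_d(n)=(s(n)\bmod d,\ s(n+1)\bmod d)$, and let $\mathcal S_d=\{(i\bmod d, j\bmod d): \gcd(i,j,d)=1\}$. -}

module Defs where

open import Data.Nat using (ℕ; zero; suc; _+_; _*_; _%_; _≥_; NonZero)
open import Data.Nat.DivMod using (_/_)
open import Data.Nat.GCD using (gcd)
open import Data.Product using (_×_; _,_; ∃; Σ; ∃-syntax)
open import Relation.Binary.PropositionalEquality using (_≡_)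

-- Stern's sequence, computed with a fuel parameter so that it is
-- structurally recursive.  sternAux f n equals s(n) whenever f ≥ n
-- (fuel only decreases by one per recursive call while the argument halves).
sternAux : ℕ → ℕ → ℕ
sternAux _ 0 = 0
sternAux _ 1 = 1
sternAux zero (suc (suc _)) = 0
sternAux (suc f) (suc (suc k)) with (suc (suc k)) % 2
... | 0 = sternAux f ((suc (suc k)) / 2)
... | _ = sternAux f ((suc (suc k)) / 2) + sternAux f (suc ((suc (suc k)) / 2))

s : ℕ → ℕ
s n = sternAux n n

S : (d : ℕ) → .{{NonZero d}} → ℕ → ℕ × ℕ
S d n = (s n % d , s (suc n) % d)

𝒮 : (d : ℕ) → .{{NonZero d}} → ℕ × ℕ → Set
𝒮 d p = ∃[ i ] ∃[ j ] (gcd (gcd i j) d ≡ 1 × p ≡ (i % d , j % d))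

{-# OPTIONS --safe #-}
module Submission where

-- Consecutive Stern values are coprime: (s(2m), s(2m+1)) and (s(2m+1), s(2m+2)) arise from
-- (s(m), s(m+1)) by the Calkin–Wilf moves (x, y) ↦ (x, x + y) and (x, y) ↦ (x + y, y).
-- Running these moves backwards is the subtractive Euclidean algorithm, so every coprime
-- pair of positive integers is (s(n), s(n+1)) for some n.  For the converse modulo d, lift
-- residues i, j with gcd(i, j, d) = 1 to the pair (d + i, d + j + k d); choosing k prime
-- by prime along the factorisation of d + i makes this pair coprime.

open import Defs
open import Data.Nat
open import Data.Nat.Properties
open import Data.Nat.DivMod
open import Data.Nat.Divisibility
open import Data.Nat.GCD using (gcd; gcd-greatest)
import Data.Nat.Coprimality as Coprime
open Coprime using (Coprime; 1-coprimeTo; coprime-divisor; coprime⇒gcd≡1)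
open import Data.Nat.Primality using (Prime; ¬prime[1]; prime⇒irreducible; euclidsLemma)
open import Data.Nat.Primality.Factorisation using (factorise)
open import Data.Nat.ListAction using (product)
open import Data.Nat.Induction using (<-wellFounded)
open import Data.List using (_∷_)
open import Data.List.Relation.Unary.All using (All; []; _∷_)
open import Data.Product using (_×_; _,_; ∃-syntax)
open import Data.Sum using (inj₁; inj₂)
open import Function using (_⇔_; mk⇔; Equivalence)
open import Induction.WellFounded using (Acc; acc)
open import Relation.Nullary using (¬_; yes; no; contradiction)
open import Relation.Binary.PropositionalEquality
open ≡-Reasoning

sternAux-double : ∀ f m → sternAux (suc f) (suc m * 2) ≡ sternAux f (suc m)
sternAux-double f m = begin
  sternAux (suc f) (suc m * 2)  ≡⟨ unfold (m*n%n≡0 (suc m) 2) ⟩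
  sternAux f (suc m * 2 / 2)    ≡⟨ cong (sternAux f) (m*n/n≡m (suc m) 2) ⟩
  sternAux f (suc m)            ∎
  where
  unfold : suc m * 2 % 2 ≡ 0 → sternAux (suc f) (suc m * 2) ≡ sternAux f (suc m * 2 / 2)
  unfold even rewrite even = refl

sternAux-double+1 : ∀ f m →
  sternAux (suc f) (suc (suc m * 2)) ≡ sternAux f (suc m) + sternAux f (suc (suc m))
sternAux-double+1 f m = begin
  sternAux (suc f) n                      ≡⟨ unfold ([m+kn]%n≡m%n 1 (suc m) 2) ⟩
  sternAux f (n / 2) + sternAux f (suc (n / 2))
    ≡⟨ cong (λ h → sternAux f h + sternAux f (suc h)) n/2≡1+m ⟩
  sternAux f (suc m) + sternAux f (suc (suc m)) ∎
  where
  n = suc (suc m * 2)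
  unfold : n % 2 ≡ 1 → sternAux (suc f) n ≡ sternAux f (n / 2) + sternAux f (suc (n / 2))
  unfold odd rewrite odd = refl
  n/2≡1+m : n / 2 ≡ suc m
  n/2≡1+m = trans (+-distrib-/-∣ʳ 1 {d = 2} (divides-refl (suc m))) (m*n/n≡m (suc m) 2)

-- Halves are written suc m * 2, which reduces to the shape suc (suc (m * 2)) that sternAux
-- matches on.
data Halving : ℕ → Set where
  zero     : Halving 0
  one      : Halving 1
  double   : ∀ m → Halving (suc m * 2)
  double+1 : ∀ m → Halving (suc (suc m * 2))

halving : ∀ n → Halving n
halving 0 = zero
halving 1 = one
halving (suc (suc n)) with halving n
... | zero       = double 0
... | one        = double+1 0
... | double m   = double (suc m)
... | double+1 m = double+1 (suc m)

1+m<[1+m]*2 : ∀ m → suc m < suc m * 2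
1+m<[1+m]*2 m = s≤s (s≤s (m≤m*n m 2))

sternAux-fuel : ∀ {f g} n → n ≤ f → n ≤ g → sternAux f n ≡ sternAux g n
sternAux-fuel n n≤f n≤g with halving n
sternAux-fuel _ _ _ | zero = refl
sternAux-fuel _ _ _ | one  = refl
sternAux-fuel {suc f} {suc g} _ (s≤s n≤f) (s≤s n≤g) | double m = begin
  sternAux (suc f) (suc m * 2)  ≡⟨ sternAux-double f m ⟩
  sternAux f (suc m)            ≡⟨ sternAux-fuel (suc m) (half≤ n≤f) (half≤ n≤g) ⟩
  sternAux g (suc m)            ≡⟨ sternAux-double g m ⟨
  sternAux (suc g) (suc m * 2)  ∎
  where
  half≤ : ∀ {h} → suc (m * 2) ≤ h → suc m ≤ h
  half≤ = ≤-trans (s≤s (m≤m*n m 2))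
sternAux-fuel {suc f} {suc g} _ (s≤s n≤f) (s≤s n≤g) | double+1 m = begin
  sternAux (suc f) (suc (suc m * 2))             ≡⟨ sternAux-double+1 f m ⟩
  sternAux f (suc m) + sternAux f (suc (suc m))
    ≡⟨ cong₂ _+_ (sternAux-fuel (suc m) (<⇒≤ (half< n≤f)) (<⇒≤ (half< n≤g)))
                 (sternAux-fuel (suc (suc m)) (half< n≤f) (half< n≤g)) ⟩
  sternAux g (suc m) + sternAux g (suc (suc m))  ≡⟨ sternAux-double+1 g m ⟨
  sternAux (suc g) (suc (suc m * 2))             ∎
  where
  half< : ∀ {h} → suc m * 2 ≤ h → suc m < h
  half< = <-≤-trans (1+m<[1+m]*2 m)

s-double : ∀ m → s (m * 2) ≡ s m
s-double zero    = refl
s-double (suc m) =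
  trans (sternAux-double _ m) (sternAux-fuel (suc m) (s≤s (m≤m*n m 2)) ≤-refl)

s-double+1 : ∀ m → s (suc (m * 2)) ≡ s m + s (suc m)
s-double+1 zero    = refl
s-double+1 (suc m) = trans (sternAux-double+1 _ m)
  (cong₂ _+_ (sternAux-fuel (suc m) (<⇒≤ (1+m<[1+m]*2 m)) ≤-refl)
             (sternAux-fuel (suc (suc m)) (1+m<[1+m]*2 m) ≤-refl))

∣m+n∣n⇒∣m : ∀ {d m n} → d ∣ m + n → d ∣ n → d ∣ m
∣m+n∣n⇒∣m {d} {m} {n} d∣m+n = ∣m+n∣m⇒∣n (subst (d ∣_) (+-comm m n) d∣m+n)

coprime-+ʳ : ∀ {m n} → Coprime m n ⇔ Coprime m (m + n)
coprime-+ʳ = mk⇔ (λ c {_} (i∣m , i∣m+n) → c (i∣m , ∣m+n∣m⇒∣n i∣m+n i∣m))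
                 (λ c {_} (i∣m , i∣n) → c (i∣m , ∣m∣n⇒∣m+n i∣m i∣n))

coprime-+ˡ : ∀ {m n} → Coprime m n ⇔ Coprime (m + n) n
coprime-+ˡ = mk⇔ (λ c {_} (i∣m+n , i∣n) → c (∣m+n∣n⇒∣m i∣m+n i∣n , i∣n))
                 (λ c {_} (i∣m , i∣n) → c (∣m∣n⇒∣m+n i∣m i∣n , i∣n))

s-consecutive-coprime : ∀ n → Coprime (s n) (s (suc n))
s-consecutive-coprime n = go (<-wellFounded n)
  where
  go : ∀ {n} → Acc _<_ n → Coprime (s n) (s (suc n))
  go {n} (acc rec) with halving n
  ... | zero       = Coprime.sym (1-coprimeTo 0)
  ... | one        = 1-coprimeTo 1
  ... | double m   = subst₂ Coprime (sym (s-double (suc m))) (sym (s-double+1 (suc m)))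
    (Equivalence.to coprime-+ʳ (go (rec (1+m<[1+m]*2 m))))
  ... | double+1 m = subst₂ Coprime (sym (s-double+1 (suc m))) (sym (s-double (suc (suc m))))
    (Equivalence.to coprime-+ˡ (go (rec (m<n⇒m<1+n (1+m<[1+m]*2 m)))))

coprime⇒s-consecutive : ∀ {a b} .{{_ : NonZero a}} .{{_ : NonZero b}} →
  Coprime a b → ∃[ n ] s n ≡ a × s (suc n) ≡ b
coprime⇒s-consecutive {suc a} {suc b} = go (<-wellFounded (a + b))
  where
  go : ∀ {a b} → Acc _<_ (a + b) → Coprime (suc a) (suc b) →
       ∃[ n ] s n ≡ suc a × s (suc n) ≡ suc b
  go {a} {b} (acc rec) cop with compare a b
  ... | equal a = 1 , 1≡1+a , 1≡1+a
    where
    1≡1+a : 1 ≡ suc a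
    1≡1+a = sym (cop (∣-refl , ∣-refl))
  ... | less a k =
    let n , sn≡ , s1+n≡ = go (rec (+-monoʳ-< a (s≤s (m≤n+m k a))))
          (Equivalence.from coprime-+ʳ (subst (Coprime (suc a)) (sym sum) cop))
    in n * 2 , trans (s-double n) sn≡ , (begin
      s (suc (n * 2))   ≡⟨ s-double+1 n ⟩
      s n + s (suc n)   ≡⟨ cong₂ _+_ sn≡ s1+n≡ ⟩
      suc a + suc k     ≡⟨ sum ⟩
      suc (suc (a + k)) ∎)
    where
    sum : suc a + suc k ≡ suc (suc (a + k))
    sum = cong suc (+-suc a k)
  ... | greater b k =
    let n , sn≡ , s1+n≡ = go (rec (+-monoˡ-< b (s≤s (m≤n+m k b))))
          (Equivalence.from coprime-+ˡ (subst (λ x → Coprime x (suc b)) (sym sum) cop))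
    in suc (n * 2) , (begin
      s (suc (n * 2))   ≡⟨ s-double+1 n ⟩
      s n + s (suc n)   ≡⟨ cong₂ _+_ sn≡ s1+n≡ ⟩
      suc k + suc b     ≡⟨ sum ⟩
      suc (suc (b + k)) ∎) , trans (s-double (suc n)) s1+n≡
    where
    sum : suc k + suc b ≡ suc (suc (b + k))
    sum = cong suc (trans (+-suc k b) (cong suc (+-comm k b)))

prime∤⇒coprime : ∀ {p n} → Prime p → ¬ p ∣ n → Coprime p n
prime∤⇒coprime p-prime p∤n {i} (i∣p , i∣n) with prime⇒irreducible p-prime i∣p
... | inj₁ i≡1  = i≡1
... | inj₂ refl = contradiction i∣n p∤n

coprime-*ˡ : ∀ {m n o} → Coprime m o → Coprime n o → Coprime (m * n) o
coprime-*ˡ {m} m⊥o n⊥o {i} (i∣mn , i∣o) = n⊥o (coprime-divisor i⊥m i∣mn , i∣o)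
  where
  i⊥m : Coprime i m
  i⊥m (j∣i , j∣m) = m⊥o (j∣m , ∣-trans j∣i i∣o)

Coprime₃ : ℕ → ℕ → ℕ → Set
Coprime₃ a b c = ∀ {i} → i ∣ a → i ∣ b → i ∣ c → i ≡ 1

-- If p ∣ b + k c then p ∤ a and p ∤ c, so passing from k to k + a keeps b + k c
-- coprime to a while moving it off the multiples of p.
coprime-shift-prime : ∀ {p a b c k} → Prime p → Coprime₃ (p * a) b c →
  Coprime a (b + k * c) → ∃[ k′ ] Coprime (p * a) (b + k′ * c)
coprime-shift-prime {p} {a} {b} {c} {k} p-prime cop₃ a⊥x with p ∣? b + k * c
... | no p∤x  = k , coprime-*ˡ (prime∤⇒coprime p-prime p∤x) a⊥x
... | yes p∣x = k + a , coprime-*ˡ (prime∤⇒coprime p-prime p∤x′) a⊥x′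
  where
  x′≡x+ac : b + (k + a) * c ≡ (b + k * c) + a * c
  x′≡x+ac = begin
    b + (k + a) * c        ≡⟨ cong (b +_) (*-distribʳ-+ c k a) ⟩
    b + (k * c + a * c)    ≡⟨ +-assoc b (k * c) (a * c) ⟨
    (b + k * c) + a * c    ∎
  p≢1 : p ≢ 1
  p≢1 refl = ¬prime[1] p-prime
  a⊥x′ : Coprime a (b + (k + a) * c)
  a⊥x′ {i} (i∣a , i∣x′) =
    a⊥x (i∣a , ∣m+n∣n⇒∣m (subst (i ∣_) x′≡x+ac i∣x′) (∣m⇒∣m*n c i∣a))
  p∣x′⇒p∣ac : p ∣ b + (k + a) * c → p ∣ a * c
  p∣x′⇒p∣ac p∣x′ = ∣m+n∣m⇒∣n (subst (p ∣_) x′≡x+ac p∣x′) p∣x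
  p∤x′ : ¬ p ∣ b + (k + a) * c
  p∤x′ p∣x′ with euclidsLemma a c p-prime (p∣x′⇒p∣ac p∣x′)
  ... | inj₁ p∣a = p≢1 (a⊥x (p∣a , p∣x))
  ... | inj₂ p∣c = p≢1 (cop₃ (m∣m*n a) p∣b p∣c)
    where
    p∣b : p ∣ b
    p∣b = ∣m+n∣n⇒∣m p∣x (∣n⇒∣m*n k p∣c)

coprime-shift-product : ∀ {ps b c} → All Prime ps → Coprime₃ (product ps) b c →
  ∃[ k ] Coprime (product ps) (b + k * c)
coprime-shift-product [] _ = 0 , 1-coprimeTo _
coprime-shift-product {p ∷ _} (p-prime ∷ ps-prime) cop₃ =
  let k , cop = coprime-shift-product ps-prime (λ i∣a → cop₃ (∣-trans i∣a (n∣m*n p)))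
  in coprime-shift-prime {k = k} p-prime cop₃ cop

coprime-shift : ∀ a .{{_ : NonZero a}} {b c} → Coprime₃ a b c →
  ∃[ k ] Coprime a (b + k * c)
coprime-shift a cop₃ with factorise a
... | record { isFactorisation = refl ; factorsPrime = ps-prime } =
  coprime-shift-product ps-prime cop₃

S-∈-𝒮 : ∀ d .{{_ : NonZero d}} n → 𝒮 d (S d n)
S-∈-𝒮 d n = s n , s (suc n) , gcd≡1 , refl
  where
  gcd≡1 : gcd (gcd (s n) (s (suc n))) d ≡ 1
  gcd≡1 = begin
    gcd (gcd (s n) (s (suc n))) d
      ≡⟨ cong (λ g → gcd g d) (coprime⇒gcd≡1 (s-consecutive-coprime n)) ⟩
    gcd 1 d
      ≡⟨ coprime⇒gcd≡1 (1-coprimeTo d) ⟩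
    1 ∎

-- Adding d makes both entries positive without changing their residues or their gcd with d.
S-surjective : ∀ d .{{_ : NonZero d}} p → 𝒮 d p → ∃[ n ] S d n ≡ p
S-surjective d@(suc _) _ (i , j , gcd≡1 , refl) =
  let k , a⊥b           = coprime-shift (d + i) cop₃
      n , sn≡a , s1+n≡b = coprime⇒s-consecutive a⊥b
  in n , cong₂ _,_
    (begin
      s n % d        ≡⟨ cong (_% d) sn≡a ⟩
      (d + i) % d    ≡⟨ %-remove-+ˡ i ∣-refl ⟩
      i % d          ∎)
    (begin
      s (suc n) % d        ≡⟨ cong (_% d) s1+n≡b ⟩
      (d + j + k * d) % d  ≡⟨ [m+kn]%n≡m%n (d + j) k d ⟩
      (d + j) % d          ≡⟨ %-remove-+ˡ j ∣-refl ⟩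
      j % d                ∎)
  where
  cop₃ : Coprime₃ (d + i) (d + j) d
  cop₃ {e} e∣d+i e∣d+j e∣d =
    ∣1⇒≡1 (subst (e ∣_) gcd≡1 (gcd-greatest e∣gcd[i,j] e∣d))
    where
    e∣gcd[i,j] : e ∣ gcd i j
    e∣gcd[i,j] = gcd-greatest (∣m+n∣m⇒∣n e∣d+i e∣d) (∣m+n∣m⇒∣n e∣d+j e∣d)

lemma4p1 : (d : ℕ) → .{{_ : NonZero d}} → d ≥ 2 →
    (∀ n → 𝒮 d (S d n)) × (∀ p → 𝒮 d p → ∃[ n ] S d n ≡ p)
lemma4p1 d _ = S-∈-𝒮 d , S-surjective d
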